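{- Let $k\ge4$ be an even integer, and let $A$ be a cyclically almost $k$-diagonal array of size $n>k$ in standard form, with extra filled position $(1,\ell)$. Suppose $R=(1,\dots,1)$ and $C\in\{ -1,1\}^n$ are a solution of $P(A)$. Let $E$ be the list of positions $j$ with $c_j=-1$. Then: 1) $c_\ell=-1$; 2) $\gcd(|E|,k/2)=1$; 3) with $d=\gcd(n,k-1)$: if $\ell\equiv1\pmod d$, the list $E$ covers all congruence classes modulo $d$; otherwise $E$ covers all congruence classes modulo $d$ except at most the class of $1$.
   Context: Arrays are toroidal: an $n\times n$ array has rows and columns indexed modulo $n$ (representatives $1,\dots,n$). Each cell is filled or empty; $F(A)$ is the set of filled cells. For $(i,j)\in F(A)$: - the row successor $s_r((i,j))$ is $(i,j+k)$ with $k\ge1$ minimal such that $(i,j+k)\in F(A)$; - the column successor $s_c((i,j))$ is $(i+k,j)$ with $k\ge1$ minimal such that $(i+k,j)\in F(A)$. Given $R,C\in\{ -1,1\}^n$, the move function is $S_{R,C}((i,j))=s_c^{\,c_{j'}}((i,j'))$, where $(i,j')=s_r^{\,r_i}((i,j))$; exponent $-1$ means inverse. $R,C$ is a solution of $P(A)$ if $S_{R,C}$ is a single cycle on $F(A)$. Diagonals: $D_i=\{(i+t-1,t): t=1,\dots,n\}$, with row indices modulo $n$. A cyclically almost $k$-diagonal array of size $n>k$ is a square array whose filled cells are exactly the cells of $k$ diagonals consecutive modulo $n$, plus one extra filled cell lying in another diagonal. Standard form: such an array is in standard form if the totally filled diagonals are $D_1,\dots,D_k$ and the extra cell is $(1,\ell)$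 with $2\le\ell\le n-k+1$. "$E$ covers a congruence class $[h]$ modulo $d$" means some element of $E$ is $\equiv h\pmod d$. -}

module Defs where

open import Data.Bool using (Bool; true; false; if_then_else_; _∧_; _∨_; T)
open import Data.Nat using (ℕ; zero; suc; _+_; _*_; _∸_; _<ᵇ_; _≡ᵇ_; NonZero)
open import Data.Nat.DivMod using (_mod_; _%_)
open import Data.Fin using (Fin; toℕ)
open import Data.Product using (_×_; _,_; proj₁; proj₂; ∃-syntax)
open import Data.List using (List; filterᵇ; length)
open import Data.List.Base using (allFin)
open import Relation.Binary.PropositionalEquality using (_≡_)

-- An n×n toroidal array is indexed by Fin n × Fin n; the Fin
-- element t represents the paper's index (toℕ t + 1) ∈ {1,…,n}.

Array : ℕ → Set
Array n = Fin n → Fin n → Bool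

Cell : ℕ → Set
Cell n = Fin n × Fin n

data Sgn : Set where
  pos neg : Sgn

isNeg : Sgn → Bool
isNeg pos = false
isNeg neg = true

search : (ℕ → Bool) → ℕ → ℕ → ℕ
search p zero    k = k
search p (suc f) k = if p k then k else search p f (suc k)

-- least m ∈ {1,…,n} with p m (n if none among 1,…,n−1)
leastPos : ℕ → (ℕ → Bool) → ℕ
leastPos n p = search p (n ∸ 1) 1

module _ {n : ℕ} .{{_ : NonZero n}} (A : Array n) where

  addMod : Fin n → ℕ → Fin n
  addMod a m = (toℕ a + m) mod n

  subMod : Fin n → ℕ → Fin n
  subMod a m = (toℕ a + (n ∸ m)) mod n

  sr : Cell n → Cell n
  sr (i , j) = i , addMod j (leastPos n (λ m → A i (addMod j m)))

  sr⁻¹ : Cell n → Cell n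
  sr⁻¹ (i , j) = i , subMod j (leastPos n (λ m → A i (subMod j m)))

  sc : Cell n → Cell n
  sc (i , j) = addMod i (leastPos n (λ m → A (addMod i m) j)) , j

  sc⁻¹ : Cell n → Cell n
  sc⁻¹ (i , j) = subMod i (leastPos n (λ m → A (subMod i m) j)) , j

  pow : Sgn → (Cell n → Cell n) → (Cell n → Cell n) → Cell n → Cell n
  pow pos f f⁻¹ = f
  pow neg f f⁻¹ = f⁻¹

  move : (R C : Fin n → Sgn) → Cell n → Cell n
  move R C (i , j) = pow (C j') sc sc⁻¹ (i , j')
    where
    j' : Fin n
    j' = proj₂ (pow (R i) sr sr⁻¹ (i , j))

  Filled : Cell n → Set
  Filled (i , j) = T (A i j)

iter : {X : Set} → (X → X) → ℕ → X → X
iter f zero    x = x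
iter f (suc m) x = f (iter f m x)

IsSingleCycle : {n : ℕ} → (Cell n → Set) → (Cell n → Cell n) → Set
IsSingleCycle {n} F S = (x y : Cell n) → F x → F y → ∃[ m ] iter S m x ≡ y

IsSolution : {n : ℕ} .{{_ : NonZero n}} → Array n → (R C : Fin n → Sgn) → Set
IsSolution A R C = IsSingleCycle (Filled A) (move A R C)

-- A cell (r,c) (paper indices)
-- lies in D_i iff r − c ≡ i − 1 (mod n); this difference is unchanged by the
-- 0-based shift, so (r,c) ∈ D_1 ∪ … ∪ D_k iff ((r − c) mod n) < k.
diagOffset : (n : ℕ) .{{_ : NonZero n}} → Fin n → Fin n → ℕ
diagOffset n r c = (toℕ r + (n ∸ toℕ c)) % n

almostDiag : (n k ℓ : ℕ) .{{_ : NonZero n}} → Array n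
almostDiag n k ℓ r c =
  (diagOffset n r c <ᵇ k) ∨ ((toℕ r ≡ᵇ 0) ∧ (suc (toℕ c) ≡ᵇ ℓ))

negPositions : {n : ℕ} → (Fin n → Sgn) → List (Fin n)
negPositions {n} C = filterᵇ (λ j → isNeg (C j)) (allFin n)

_≡_[mod_] : ℕ → ℕ → ℕ → Set
a ≡ b [mod d ] = ∃[ x ] ∃[ y ] a + x * d ≡ b + y * d

module Submission where

-- A cell (r , c) lies on diagonal t when r ≡ c + t (mod n); A fills diagonals
-- 0, …, k − 1 plus the extra cell (0 , ℓ − 1).  With R = (1, …, 1) a move is a row
-- step followed by a column step down or up according to the sign of the column,
-- and each step either reaches a neighbouring cell or jumps the gap of the n − k
-- empty diagonals.  Every conclusion is proved by contraposition: a single cycle has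
-- no invariant set of cells containing one filled cell and missing another
-- (noInvariantSet), and a failure of the conclusion yields such a set, namely
--   1) the odd diagonals, if the extra column is positive (oddTrap);
--   2) the cells on odd diagonal 2u + 1 of column c with u + N c fixed modulo a
--      common divisor g ≥ 2 of |E| and k/2, where N c counts negative columns up
--      to c (countingTrap);
--   3) the main-diagonal cells of a residue class modulo gcd(n, k − 1) without
--      negative columns (mainDiagonalTrap).
-- The file develops arithmetic and counting facts, the index geometry of the
-- torus (Torus), the successors in the almost-diagonal array (AlmostDiagonal), the
-- three traps, and finally the proposition.

open import Defs
open import Data.Bool using (Bool; true; false; T; _∧_)
open import Data.Bool.Properties using (∧-zeroʳ)
open import Data.Empty using (⊥-elim)
open import Data.Fin using (Fin; toℕ; fromℕ<)
import Data.Fin as Fin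
open import Data.Fin.Properties using (toℕ-fromℕ<; toℕ-injective; toℕ<n)
open import Data.List using (length; filterᵇ; tabulate)
open import Data.List.Membership.Propositional using (_∈_; find; lose)
open import Data.List.Membership.Propositional.Properties using (∈-filter⁺; ∈-allFin)
open import Data.List.Relation.Unary.Any using (any?)
open import Data.Nat
open import Data.Nat.Coprimality using (Coprime; coprime⇒gcd≡1)
open import Data.Nat.DivMod
open import Data.Nat.Divisibility using (_∣_; divides; ∣m+n∣m⇒∣n; ∣⇒≤; n∣m*n; 0∣⇒≡0)
open import Data.Nat.GCD using (gcd; gcd[m,n]∣m; gcd[m,n]∣n; gcd[m,n]≢0)
open import Data.Nat.Properties
open import Data.Product using (_×_; _,_; proj₁; proj₂; ∃-syntax)
open import Data.Sum using (_⊎_; inj₁; inj₂)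
open import Data.Unit using (tt)
open import Relation.Binary.PropositionalEquality
open import Relation.Nullary using (¬_; Dec; yes; no; contradiction)
open import Relation.Nullary.Decidable using (dec-true; dec-false; T?)

[m%n+k]%n≡[m+k]%n : ∀ m k n .{{_ : NonZero n}} → (m % n + k) % n ≡ (m + k) % n
[m%n+k]%n≡[m+k]%n m k n = begin
  (m % n + k) % n           ≡⟨ %-distribˡ-+ (m % n) k n ⟩
  (m % n % n + k % n) % n   ≡⟨ cong (λ x → (x + k % n) % n) (m%n%n≡m%n m n) ⟩
  (m % n + k % n) % n       ≡⟨ %-distribˡ-+ m k n ⟨
  (m + k) % n               ∎
  where open ≡-Reasoning

%-cong-+ : ∀ {a b c e} d .{{_ : NonZero d}} → a % d ≡ b % d → c % d ≡ e % d → (a + c) % d ≡ (b + e) % d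
%-cong-+ {a} {b} {c} {e} d a≡b c≡e = begin
  (a + c) % d             ≡⟨ %-distribˡ-+ a c d ⟩
  (a % d + c % d) % d     ≡⟨ cong₂ (λ x y → (x + y) % d) a≡b c≡e ⟩
  (b % d + e % d) % d     ≡⟨ %-distribˡ-+ b e d ⟨
  (b + e) % d             ∎
  where open ≡-Reasoning

≡[mod]⇒%≡ : ∀ {a b} d .{{_ : NonZero d}} → a ≡ b [mod d ] → a % d ≡ b % d
≡[mod]⇒%≡ {a} {b} d (x , y , eq) = begin
  a % d           ≡⟨ [m+kn]%n≡m%n a x d ⟨
  (a + x * d) % d ≡⟨ cong (_% d) eq ⟩
  (b + y * d) % d ≡⟨ [m+kn]%n≡m%n b y d ⟩
  b % d           ∎
  where open ≡-Reasoning

%≡⇒≡[mod] : ∀ {a b} d .{{_ : NonZero d}} → a % d ≡ b % d → a ≡ b [mod d ]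
%≡⇒≡[mod] {a} {b} d eq = b / d , a / d , (begin
  a + b / d * d               ≡⟨ cong (_+ b / d * d) (m≡m%n+[m/n]*n a d) ⟩
  a % d + a / d * d + b / d * d ≡⟨ cong (λ x → x + a / d * d + b / d * d) eq ⟩
  b % d + a / d * d + b / d * d ≡⟨ +-assoc (b % d) _ _ ⟩
  b % d + (a / d * d + b / d * d) ≡⟨ cong (b % d +_) (+-comm (a / d * d) _) ⟩
  b % d + (b / d * d + a / d * d) ≡⟨ +-assoc (b % d) _ _ ⟨
  b % d + b / d * d + a / d * d ≡⟨ cong (_+ a / d * d) (m≡m%n+[m/n]*n b d) ⟨
  b + a / d * d               ∎)
  where open ≡-Reasoning

%-weaken : ∀ {a b g h} .{{_ : NonZero g}} .{{_ : NonZero h}} → g ∣ h → a % h ≡ b % h → a % g ≡ b % g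
%-weaken {a} {b} {g} {h} g∣h a≡b = begin
  a % g       ≡⟨ m∣n⇒o%n%m≡o%m g h a g∣h ⟨
  a % h % g   ≡⟨ cong (_% g) a≡b ⟩
  b % h % g   ≡⟨ m∣n⇒o%n%m≡o%m g h b g∣h ⟩
  b % g       ∎
  where open ≡-Reasoning

suc-%-≢ : ∀ {g} .{{_ : NonZero g}} → 2 ≤ g → ∀ x → suc x % g ≢ x % g
suc-%-≢ {g} 2≤g x sx≡x with %≡⇒≡[mod] g sx≡x
... | p , q , sx+pg≡x+qg = <⇒≱ 2≤g (∣⇒≤ (∣m+n∣m⇒∣n g∣pg+1 (n∣m*n p)))
  where
  pg+1≡qg : suc (p * g) ≡ q * g
  pg+1≡qg = +-cancelˡ-≡ x _ _ (trans (+-suc x (p * g)) sx+pg≡x+qg)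
  g∣pg+1 : g ∣ p * g + 1
  g∣pg+1 = subst (g ∣_) (trans (sym pg+1≡qg) (+-comm 1 (p * g))) (n∣m*n q)

search-first : ∀ (p : ℕ → Bool) f s j → (∀ i → i < j → p (s + i) ≡ false) → p (s + j) ≡ true
  → j < f → search p f s ≡ s + j
search-first p (suc f) s zero _ pj _ rewrite +-identityʳ s | pj = refl
search-first p (suc f) s (suc j) below pj (s≤s j<f)
  rewrite trans (cong p (sym (+-identityʳ s))) (below 0 z<s) = begin
    search p f (suc s) ≡⟨ search-first p f (suc s) j below′ (trans (cong p (sym (+-suc s j))) pj) j<f ⟩
    suc s + j          ≡⟨ +-suc s j ⟨
    s + suc j          ∎
  where
  open ≡-Reasoning
  below′ : ∀ i → i < j → p (suc s + i) ≡ false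
  below′ i i<j = trans (cong p (sym (+-suc s i))) (below (suc i) (s≤s i<j))

leastPos-first : ∀ n (p : ℕ → Bool) j → (∀ i → i < j → p (suc i) ≡ false) → p (suc j) ≡ true
  → suc j < n → leastPos n p ≡ suc j
leastPos-first (suc n) p j below pj (s≤s j<n) = search-first p n 1 j below pj j<n

weight : Sgn → ℕ
weight pos = 0
weight neg = 1

negCount : (ℕ → Sgn) → ℕ → ℕ
negCount s zero    = 0
negCount s (suc m) = negCount s m + weight (s m)

negCount-suc : ∀ s m → negCount s (suc m) ≡ weight (s 0) + negCount (λ i → s (suc i)) m
negCount-suc s zero    = +-comm 0 (weight (s 0))
negCount-suc s (suc m) rewrite negCount-suc s m = +-assoc (weight (s 0)) _ _

length-filter-neg : ∀ {X : Set} m (σ : X → Sgn) (f : Fin m → X) (s : ℕ → Sgn)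
  → (∀ j → σ (f j) ≡ s (toℕ j)) → length (filterᵇ (λ x → isNeg (σ x)) (tabulate f)) ≡ negCount s m
length-filter-neg zero    σ f s eq = refl
length-filter-neg (suc m) σ f s eq rewrite negCount-suc s m | eq Fin.zero with s 0
... | pos = length-filter-neg m σ (λ j → f (Fin.suc j)) (λ i → s (suc i)) (λ j → eq (Fin.suc j))
... | neg = cong suc (length-filter-neg m σ (λ j → f (Fin.suc j)) (λ i → s (suc i)) (λ j → eq (Fin.suc j)))

∈-negPositions : ∀ {n} (C : Fin n → Sgn) {c} → C c ≡ neg → c ∈ negPositions C
∈-negPositions C {c} Cc = ∈-filter⁺ (λ j → T? (isNeg (C j))) (∈-allFin c) (subst (λ s → T (isNeg s)) (sym Cc) tt)

column : ∀ {n ℓ} → 1 ≤ ℓ → ℓ ≤ n → ∃[ e ] suc (toℕ {n} e) ≡ ℓ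
column {ℓ = suc ℓ′} _ ℓ≤n = fromℕ< ℓ≤n , cong suc (toℕ-fromℕ< ℓ≤n)

noInvariantSet : ∀ {n} {F : Cell n → Set} {S : Cell n → Cell n} (I : Cell n → Set)
  → (∀ x → I x → I (S x)) → ∀ x y → F x → F y → I x → ¬ I y → ¬ IsSingleCycle F S
noInvariantSet {S = S} I inv x y fx fy ix ¬iy cycle with cycle x y fx fy
... | m , Sᵐx≡y = ¬iy (subst I Sᵐx≡y (iterate m))
  where
  iterate : ∀ m → I (iter S m x)
  iterate zero    = ix
  iterate (suc m) = inv _ (iterate m)

-- Index arithmetic on the torus and the diagonals of an n × n array.
module Torus {n : ℕ} .{{_ : NonZero n}} where

  infixl 6 _⊕_ _⊖_

  _⊕_ : Fin n → ℕ → Fin n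
  a ⊕ m = (toℕ a + m) mod n

  _⊖_ : Fin n → ℕ → Fin n
  a ⊖ m = (toℕ a + (n ∸ m)) mod n

  toℕ-⊕ : ∀ a m → toℕ (a ⊕ m) ≡ (toℕ a + m) % n
  toℕ-⊕ a m = toℕ-fromℕ< _

  toℕ-⊖ : ∀ a m → toℕ (a ⊖ m) ≡ (toℕ a + (n ∸ m)) % n
  toℕ-⊖ a m = toℕ-fromℕ< _

  -- The cell (r , c) lies on the diagonal D_{t+1}: r ≡ c + t modulo n.
  OnDiag : Fin n → Fin n → ℕ → Set
  OnDiag r c t = toℕ r ≡ (toℕ c + t) % n

  [a+[t+n]]%n≡[a+t]%n : ∀ a t → (a + (t + n)) % n ≡ (a + t) % n
  [a+[t+n]]%n≡[a+t]%n a t = trans (cong (_% n) (sym (+-assoc a t n))) ([m+n]%n≡m%n (a + t) n)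

  onDiag-+n : ∀ {r c t} → OnDiag r c t → OnDiag r c (t + n)
  onDiag-+n {c = c} {t} rct = trans rct (sym ([a+[t+n]]%n≡[a+t]%n (toℕ c) t))

  onDiag-∸n : ∀ {r c t} → OnDiag r c (t + n) → OnDiag r c t
  onDiag-∸n {c = c} {t} rct = trans rct ([a+[t+n]]%n≡[a+t]%n (toℕ c) t)

  onDiag-⊕col : ∀ {r c t} m → OnDiag r c (m + t) → OnDiag r (c ⊕ m) t
  onDiag-⊕col {r} {c} {t} m rct = trans rct (begin
    (toℕ c + (m + t)) % n     ≡⟨ cong (_% n) (+-assoc (toℕ c) m t) ⟨
    (toℕ c + m + t) % n       ≡⟨ [m%n+k]%n≡[m+k]%n (toℕ c + m) t n ⟨
    ((toℕ c + m) % n + t) % n ≡⟨ cong (λ x → (x + t) % n) (toℕ-⊕ c m) ⟨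
    (toℕ (c ⊕ m) + t) % n     ∎)
    where open ≡-Reasoning

  onDiag-⊕row : ∀ {r c t} m → OnDiag r c t → OnDiag (r ⊕ m) c (m + t)
  onDiag-⊕row {r} {c} {t} m rct = begin
    toℕ (r ⊕ m)               ≡⟨ toℕ-⊕ r m ⟩
    (toℕ r + m) % n           ≡⟨ cong (λ x → (x + m) % n) rct ⟩
    ((toℕ c + t) % n + m) % n ≡⟨ [m%n+k]%n≡[m+k]%n (toℕ c + t) m n ⟩
    (toℕ c + t + m) % n       ≡⟨ cong (_% n) (+-assoc (toℕ c) t m) ⟩
    (toℕ c + (t + m)) % n     ≡⟨ cong (λ x → (toℕ c + x) % n) (+-comm t m) ⟩
    (toℕ c + (m + t)) % n     ∎
    where open ≡-Reasoning

  onDiag-⊖row : ∀ {r c t} m → m ≤ n → OnDiag r c (m + t) → OnDiag (r ⊖ m) c t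
  onDiag-⊖row {r} {c} {t} m m≤n rct = begin
    toℕ (r ⊖ m)                           ≡⟨ toℕ-⊖ r m ⟩
    (toℕ r + (n ∸ m)) % n                 ≡⟨ cong (λ x → (x + (n ∸ m)) % n) rct ⟩
    ((toℕ c + (m + t)) % n + (n ∸ m)) % n ≡⟨ [m%n+k]%n≡[m+k]%n (toℕ c + (m + t)) (n ∸ m) n ⟩
    (toℕ c + (m + t) + (n ∸ m)) % n       ≡⟨ cong (_% n) (+-assoc (toℕ c) (m + t) (n ∸ m)) ⟩
    (toℕ c + (m + t + (n ∸ m))) % n       ≡⟨ cong (λ x → (toℕ c + x) % n) shuffle ⟩
    (toℕ c + (t + n)) % n                 ≡⟨ [a+[t+n]]%n≡[a+t]%n (toℕ c) t ⟩
    (toℕ c + t) % n                       ∎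
    where
    open ≡-Reasoning
    shuffle : m + t + (n ∸ m) ≡ t + n
    shuffle = begin
      m + t + (n ∸ m)   ≡⟨ cong (_+ (n ∸ m)) (+-comm m t) ⟩
      t + m + (n ∸ m)   ≡⟨ +-assoc t m (n ∸ m) ⟩
      t + (m + (n ∸ m)) ≡⟨ cong (t +_) (m+[n∸m]≡n m≤n) ⟩
      t + n             ∎

  onDiag-⊕col-wrap : ∀ {r c} m → m ≤ n → OnDiag r c 0 → OnDiag r (c ⊕ m) (n ∸ m)
  onDiag-⊕col-wrap {r} {c} m m≤n rc0 =
    onDiag-⊕col {r} {c} m (subst (OnDiag r c) (sym (m+[n∸m]≡n m≤n)) (onDiag-+n {r} {c} {0} rc0))

  onDiag-⊖row-wrap : ∀ {r c} m → m ≤ n → OnDiag r c 0 → OnDiag (r ⊖ m) c (n ∸ m)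
  onDiag-⊖row-wrap {r} {c} m m≤n rc0 =
    onDiag-⊖row {r} {c} m m≤n (subst (OnDiag r c) (sym (m+[n∸m]≡n m≤n)) (onDiag-+n {r} {c} {0} rc0))

  onDiag-diagonal : ∀ c → OnDiag c c 0
  onDiag-diagonal c = sym (trans (cong (_% n) (+-identityʳ (toℕ c))) (m<n⇒m%n≡m (toℕ<n c)))

  diagOffset-onDiag : ∀ {r c t} → OnDiag r c t → t < n → diagOffset n r c ≡ t
  diagOffset-onDiag {r} {c} {t} rct t<n = begin
    (toℕ r + (n ∸ toℕ c)) % n           ≡⟨ cong (λ x → (x + (n ∸ toℕ c)) % n) rct ⟩
    ((toℕ c + t) % n + (n ∸ toℕ c)) % n ≡⟨ [m%n+k]%n≡[m+k]%n (toℕ c + t) (n ∸ toℕ c) n ⟩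
    (toℕ c + t + (n ∸ toℕ c)) % n       ≡⟨ cong (λ x → (x + (n ∸ toℕ c)) % n) (+-comm (toℕ c) t) ⟩
    (t + toℕ c + (n ∸ toℕ c)) % n       ≡⟨ cong (_% n) (+-assoc t (toℕ c) (n ∸ toℕ c)) ⟩
    (t + (toℕ c + (n ∸ toℕ c))) % n     ≡⟨ cong (λ x → (t + x) % n) (m+[n∸m]≡n (<⇒≤ (toℕ<n c))) ⟩
    (t + n) % n                         ≡⟨ [m+n]%n≡m%n t n ⟩
    t % n                               ≡⟨ m<n⇒m%n≡m t<n ⟩
    t                                   ∎
    where open ≡-Reasoning

  module PrefixCount (C : Fin n → Sgn) where

    signAt : ℕ → Sgn
    signAt i = C (i mod n)

    signAt-toℕ : ∀ j → signAt (toℕ j) ≡ C j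
    signAt-toℕ j = cong C (toℕ-injective (trans (toℕ-fromℕ< _) (m<n⇒m%n≡m (toℕ<n j))))

    N : Fin n → ℕ
    N c = negCount signAt (suc (toℕ c))

    length-negPositions : length (negPositions C) ≡ negCount signAt n
    length-negPositions = length-filter-neg n C (λ j → j) signAt (λ j → sym (signAt-toℕ j))

    -- Modulo any divisor g of |E|, N grows by the weight of each next column,
    -- also across the wrap from column n − 1 to column 0.
    N-step : ∀ g .{{_ : NonZero g}} → g ∣ length (negPositions C) → ∀ c
      → N (c ⊕ 1) % g ≡ (N c + weight (C (c ⊕ 1))) % g
    N-step g g∣E c with m≤n⇒m<n∨m≡n (toℕ<n c)
    ... | inj₁ c+1<n = cong (_% g) (begin
      negCount signAt (suc (toℕ (c ⊕ 1)))  ≡⟨ cong (λ i → negCount signAt (suc i)) next ⟩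
      N c + weight (signAt (suc (toℕ c)))  ≡⟨ cong (λ i → N c + weight (signAt i)) next ⟨
      N c + weight (signAt (toℕ (c ⊕ 1)))  ≡⟨ cong (λ s → N c + weight s) (signAt-toℕ (c ⊕ 1)) ⟩
      N c + weight (C (c ⊕ 1))             ∎)
      where
      open ≡-Reasoning
      next : toℕ (c ⊕ 1) ≡ suc (toℕ c)
      next = trans (toℕ-⊕ c 1) (trans (cong (_% n) (+-comm (toℕ c) 1)) (m<n⇒m%n≡m c+1<n))
    ... | inj₂ c+1≡n = begin
      negCount signAt (suc (toℕ (c ⊕ 1))) % g ≡⟨ cong (λ i → negCount signAt (suc i) % g) wrap ⟩
      weight (signAt 0) % g                   ≡⟨ cong (λ i → weight (signAt i) % g) wrap ⟨
      weight (signAt (toℕ (c ⊕ 1))) % g       ≡⟨ cong (λ s → weight s % g) (signAt-toℕ (c ⊕ 1)) ⟩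
      weight (C (c ⊕ 1)) % g                  ≡⟨ %-remove-+ˡ (weight (C (c ⊕ 1))) g∣Nc ⟨
      (N c + weight (C (c ⊕ 1))) % g          ∎
      where
      open ≡-Reasoning
      wrap : toℕ (c ⊕ 1) ≡ 0
      wrap = trans (toℕ-⊕ c 1) (trans (cong (_% n) (trans (+-comm (toℕ c) 1) c+1≡n)) (n%n≡0 n))
      g∣Nc : g ∣ N c
      g∣Nc = subst (g ∣_) (trans length-negPositions (cong (negCount signAt) (sym c+1≡n))) g∣E

-- The almost k-diagonal array in standard form: diagonals D_1 … D_k and the
-- extra cell in row 0 and column ℓ − 1 (0-based), which lies on none of them.
module AlmostDiagonal (n k ℓ : ℕ) .{{_ : NonZero n}} (2≤k : 2 ≤ k) (k<n : k < n) where

  open Torus {n}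

  A : Array n
  A = almostDiag n k ℓ

  onDiag-filled : ∀ {r c t} → OnDiag r c t → t < k → A r c ≡ true
  onDiag-filled {r} {c} {t} rct t<k
    rewrite diagOffset-onDiag {r} {c} rct (<-trans t<k k<n) | dec-true (t <? k) t<k = refl

  offDiag-empty : ∀ {r c t} → OnDiag r c t → k ≤ t × t < n → toℕ r ≢ 0 ⊎ suc (toℕ c) ≢ ℓ
    → A r c ≡ false
  offDiag-empty {r} {c} {t} rct (k≤t , t<n) notExtra
    rewrite diagOffset-onDiag {r} {c} rct t<n | dec-false (t <? k) (≤⇒≯ k≤t) = notExtraCell notExtra
    where
    notExtraCell : toℕ r ≢ 0 ⊎ suc (toℕ c) ≢ ℓ → ((toℕ r ≡ᵇ 0) ∧ (suc (toℕ c) ≡ᵇ ℓ)) ≡ false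
    notExtraCell (inj₁ r≢0) rewrite dec-false (toℕ r ≟ 0) r≢0 = refl
    notExtraCell (inj₂ c≢ℓ) rewrite dec-false (suc (toℕ c) ≟ ℓ) c≢ℓ = ∧-zeroʳ _

  0<k : 0 < k
  0<k = ≤-trans (s≤s z≤n) 2≤k

  1<n : 1 < n
  1<n = ≤-trans 2≤k (<⇒≤ k<n)

  0<n : 0 < n
  0<n = <-trans z<s 1<n

  k-1<k : k ∸ 1 < k
  k-1<k = ∸-monoʳ-< z<s 0<k

  zeroF : Fin n
  zeroF = fromℕ< 0<n

  toℕ-zeroF : toℕ zeroF ≡ 0
  toℕ-zeroF = toℕ-fromℕ< _

  filled : ∀ {r c} → A r c ≡ true → Filled A (r , c)
  filled Arc = subst T (sym Arc) _

  -- Crossing the n − k empty diagonals is a jump of width w = n − k + 1.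
  w : ℕ
  w = suc (n ∸ k)

  w+k-1≡n : w + (k ∸ 1) ≡ n
  w+k-1≡n = begin
    suc (n ∸ k) + (k ∸ 1)   ≡⟨ +-suc (n ∸ k) (k ∸ 1) ⟨
    n ∸ k + suc (k ∸ 1)     ≡⟨ cong (n ∸ k +_) (m+[n∸m]≡n 0<k) ⟩
    n ∸ k + k               ≡⟨ m∸n+n≡m (<⇒≤ k<n) ⟩
    n                       ∎
    where open ≡-Reasoning

  w<n : w < n
  w<n = subst (w <_) w+k-1≡n (m<m+n w (≤-trans (s≤s z≤n) (∸-monoˡ-≤ 1 2≤k)))

  n∸w≡k-1 : n ∸ w ≡ k ∸ 1
  n∸w≡k-1 = trans (cong (_∸ w) (sym w+k-1≡n)) (m+n∸m≡n w (k ∸ 1))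

  -- The cells passed during a jump lie on the empty diagonals k, …, n − 1.
  k≤k+i<n : ∀ i → i < n ∸ k → k ≤ k + i × k + i < n
  k≤k+i<n i i<n-k = m≤m+n k i , subst (k + i <_) (m+[n∸m]≡n (<⇒≤ k<n)) (+-monoʳ-< k i<n-k)

  k≤n∸[1+i]<n : ∀ i → i < n ∸ k → k ≤ n ∸ suc i × n ∸ suc i < n
  k≤n∸[1+i]<n i i<n-k = m+n≤o⇒m≤o∸n k (subst (_≤ n) (sym (+-suc k i)) k+i<n) ,
                         ∸-monoʳ-< z<s (≤-trans (s≤s (m≤n+m i k)) k+i<n)
    where
    k+i<n : k + i < n
    k+i<n = proj₂ (k≤k+i<n i i<n-k)

  onDiag-jumpRight : ∀ {r c} → OnDiag r c 0 → OnDiag r (c ⊕ w) (k ∸ 1)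
  onDiag-jumpRight {r} {c} rc0 = subst (OnDiag r (c ⊕ w)) n∸w≡k-1 (onDiag-⊕col-wrap {r} {c} w (<⇒≤ w<n) rc0)

  onDiag-jumpUp : ∀ {r c} → OnDiag r c 0 → OnDiag (r ⊖ w) c (k ∸ 1)
  onDiag-jumpUp {r} {c} rc0 = subst (OnDiag (r ⊖ w) c) n∸w≡k-1 (onDiag-⊖row-wrap {r} {c} w (<⇒≤ w<n) rc0)

  onDiag-jumpDown : ∀ {r c} → OnDiag r c (k ∸ 1) → OnDiag (r ⊕ w) c 0
  onDiag-jumpDown {r} {c} rck = onDiag-∸n {r ⊕ w} {c} {0} (subst (OnDiag (r ⊕ w) c) w+k-1≡n (onDiag-⊕row {r} {c} w rck))

  leastPos-adjacent : ∀ (p : ℕ → Bool) → p 1 ≡ true → leastPos n p ≡ 1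
  leastPos-adjacent p p1 = leastPos-first n p 0 (λ _ ()) p1 1<n

  leastPos-gap : ∀ (p : ℕ → Bool) → (∀ i → i < n ∸ k → p (suc i) ≡ false) → p w ≡ true → leastPos n p ≡ w
  leastPos-gap p gap pw = leastPos-first n p (n ∸ k) gap pw w<n

  sr-adjacent : ∀ {r c t} → OnDiag r c (suc t) → suc t < k → sr A (r , c) ≡ (r , c ⊕ 1)
  sr-adjacent {r} {c} {t} rct st<k = cong (λ m → r , c ⊕ m)
    (leastPos-adjacent _ (onDiag-filled (onDiag-⊕col {r} {c} 1 rct) (<-trans (n<1+n t) st<k)))

  sc-adjacent : ∀ {r c t} → OnDiag r c t → suc t < k → sc A (r , c) ≡ (r ⊕ 1 , c)
  sc-adjacent {r} {c} {t} rct st<k = cong (λ m → r ⊕ m , c)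
    (leastPos-adjacent _ (onDiag-filled (onDiag-⊕row {r} {c} 1 rct) st<k))

  sc⁻¹-adjacent : ∀ {r c t} → OnDiag r c (suc t) → suc t < k → sc⁻¹ A (r , c) ≡ (r ⊖ 1 , c)
  sc⁻¹-adjacent {r} {c} {t} rct st<k = cong (λ m → r ⊖ m , c)
    (leastPos-adjacent _ (onDiag-filled (onDiag-⊖row {r} {c} 1 (<⇒≤ 1<n) rct) (<-trans (n<1+n t) st<k)))

  -- On the boundary diagonals the successors jump the gap; the extra cell, in
  -- row 0 and column ℓ − 1, can only interrupt a jump along that row or column.
  sr-gap : ∀ {r c} → OnDiag r c 0 → toℕ r ≢ 0 → sr A (r , c) ≡ (r , c ⊕ w)
  sr-gap {r} {c} rc0 r≢0 = cong (λ m → r , c ⊕ m)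
    (leastPos-gap _ empty (onDiag-filled (onDiag-jumpRight {r} {c} rc0) k-1<k))
    where
    empty : ∀ i → i < n ∸ k → A r (c ⊕ suc i) ≡ false
    empty i i<n-k = offDiag-empty (onDiag-⊕col-wrap {r} {c} (suc i) (≤-trans i<n-k (m∸n≤m n k)) rc0)
                      (k≤n∸[1+i]<n i i<n-k) (inj₁ r≢0)

  sc⁻¹-gap : ∀ {r c} → OnDiag r c 0 → suc (toℕ c) ≢ ℓ → sc⁻¹ A (r , c) ≡ (r ⊖ w , c)
  sc⁻¹-gap {r} {c} rc0 c≢ℓ = cong (λ m → r ⊖ m , c)
    (leastPos-gap _ empty (onDiag-filled (onDiag-jumpUp {r} {c} rc0) k-1<k))
    where
    empty : ∀ i → i < n ∸ k → A (r ⊖ suc i) c ≡ false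
    empty i i<n-k = offDiag-empty (onDiag-⊖row-wrap {r} {c} (suc i) (≤-trans i<n-k (m∸n≤m n k)) rc0)
                      (k≤n∸[1+i]<n i i<n-k) (inj₂ c≢ℓ)

  sc-gap : ∀ {r c} → OnDiag r c (k ∸ 1) → suc (toℕ c) ≢ ℓ → sc A (r , c) ≡ (r ⊕ w , c)
  sc-gap {r} {c} rck c≢ℓ = cong (λ m → r ⊕ m , c)
    (leastPos-gap _ empty (onDiag-filled (onDiag-jumpDown {r} {c} rck) 0<k))
    where
    passed : ∀ i → suc i + (k ∸ 1) ≡ k + i
    passed i = begin
      suc i + (k ∸ 1)   ≡⟨ +-comm (suc i) (k ∸ 1) ⟩
      k ∸ 1 + suc i     ≡⟨ +-suc (k ∸ 1) i ⟩
      suc (k ∸ 1) + i   ≡⟨ cong (_+ i) (m+[n∸m]≡n 0<k) ⟩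
      k + i             ∎
      where open ≡-Reasoning
    empty : ∀ i → i < n ∸ k → A (r ⊕ suc i) c ≡ false
    empty i i<n-k = offDiag-empty (subst (OnDiag (r ⊕ suc i) c) (passed i) (onDiag-⊕row {r} {c} (suc i) rck))
                      (k≤k+i<n i i<n-k) (inj₂ c≢ℓ)

  extraColumn-unique : ∀ {c e : Fin n} → suc (toℕ c) ≡ ℓ → suc (toℕ e) ≡ ℓ → c ≡ e
  extraColumn-unique cℓ eℓ = toℕ-injective (suc-injective (trans cℓ (sym eℓ)))

  module ColumnClasses (d : ℕ) .{{_ : NonZero d}} (d∣n : d ∣ n) (d∣k-1 : d ∣ k ∸ 1) where

    InClass : ℕ → Fin n → Set
    InClass h c = suc (toℕ c) % d ≡ h % d

    d∣w : d ∣ w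
    d∣w = ∣m+n∣m⇒∣n (subst (d ∣_) (sym (trans (+-comm (k ∸ 1) w) w+k-1≡n)) d∣n) d∣k-1

    inClass-⊕w : ∀ {h c} → InClass h c → InClass h (c ⊕ w)
    inClass-⊕w {h} {c} c∈h = trans (%-cong-+ {1} {1} d refl (begin
      toℕ (c ⊕ w) % d       ≡⟨ cong (_% d) (toℕ-⊕ c w) ⟩
      (toℕ c + w) % n % d   ≡⟨ m∣n⇒o%n%m≡o%m d n (toℕ c + w) d∣n ⟩
      (toℕ c + w) % d       ≡⟨ %-remove-+ʳ (toℕ c) d∣w ⟩
      toℕ c % d             ∎)) c∈h
      where open ≡-Reasoning

    classMember : ∀ h → InClass h ((h + (n ∸ 1)) mod n)
    classMember h = begin
      (1 + toℕ ((h + (n ∸ 1)) mod n)) % d ≡⟨ %-cong-+ {1} {1} d refl (trans (cong (_% d) (toℕ-fromℕ< _))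
                                                (m∣n⇒o%n%m≡o%m d n (h + (n ∸ 1)) d∣n)) ⟩
      (1 + (h + (n ∸ 1))) % d             ≡⟨ cong (_% d) (trans (sym (+-suc h (n ∸ 1))) (cong (h +_) (m+[n∸m]≡n 0<n))) ⟩
      (h + n) % d                         ≡⟨ %-remove-+ʳ h d∣n ⟩
      h % d                               ∎
      where open ≡-Reasoning

  module Moves (C : Fin n → Sgn) where

    mv : Cell n → Cell n
    mv = move A (λ _ → pos) C

    mv-via-sr : ∀ {r c c′} → sr A (r , c) ≡ (r , c′) → mv (r , c) ≡ pow A (C c′) (sc A) (sc⁻¹ A) (r , c′)
    mv-via-sr {r} sr≡ = cong (λ x → pow A (C (proj₂ x)) (sc A) (sc⁻¹ A) (r , proj₂ x)) sr≡

    mainDiagonalStep : ∀ {r c} → OnDiag r c 0 → toℕ r ≢ 0 → C (c ⊕ w) ≡ pos → suc (toℕ (c ⊕ w)) ≢ ℓ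
      → mv (r , c) ≡ (r ⊕ w , c ⊕ w)
    mainDiagonalStep {r} {c} rc0 r≢0 Cpos notExtra = begin
      mv (r , c)                                   ≡⟨ mv-via-sr (sr-gap rc0 r≢0) ⟩
      pow A (C (c ⊕ w)) (sc A) (sc⁻¹ A) (r , c ⊕ w) ≡⟨ cong (λ s → pow A s (sc A) (sc⁻¹ A) (r , c ⊕ w)) Cpos ⟩
      sc A (r , c ⊕ w)                             ≡⟨ sc-gap (onDiag-jumpRight rc0) notExtra ⟩
      (r ⊕ w , c ⊕ w)                              ∎
      where open ≡-Reasoning

    module _ (d : ℕ) .{{_ : NonZero d}} (d∣n : d ∣ n) (d∣k-1 : d ∣ k ∸ 1) where

      open ColumnClasses d d∣n d∣k-1

      -- Part 3: if the extra column is negative and the class of some h ≢ 1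
      -- holds only positive columns, the main-diagonal cells of that class form
      -- an invariant set, which misses the corner (0 , 0).  Its cells avoid
      -- row 0, since (0 , 0) is the only main-diagonal cell there.
      mainDiagonalTrap : ∀ e → suc (toℕ e) ≡ ℓ → C e ≡ neg
        → ∀ h → h % d ≢ 1 % d → (∀ c → InClass h c → C c ≡ pos)
        → ¬ IsSolution A (λ _ → pos) C
      mainDiagonalTrap e eℓ Ce h h≢1 classPos =
        noInvariantSet Trap invariant (c₀ , c₀) (zeroF , zeroF)
          (filled (onDiag-filled (onDiag-diagonal c₀) 0<k)) (filled (onDiag-filled (onDiag-diagonal zeroF) 0<k))
          (onDiag-diagonal c₀ , classMember h) (λ (_ , 0∈h) → notClass1 (trans (cong (λ i → suc i % d) (sym toℕ-zeroF)) 0∈h))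
        where
        notClass1 : 1 % d ≢ h % d
        notClass1 1≡h = h≢1 (sym 1≡h)
        c₀ : Fin n
        c₀ = (h + (n ∸ 1)) mod n
        Trap : Cell n → Set
        Trap (r , c) = OnDiag r c 0 × InClass h c
        invariant : ∀ x → Trap x → Trap (mv x)
        invariant (r , c) (rc0 , c∈h) =
          subst Trap (sym (mainDiagonalStep rc0 r≢0 (classPos _ c′∈h) notExtra))
                (onDiag-jumpDown (onDiag-jumpRight rc0) , c′∈h)
          where
          c′∈h : InClass h (c ⊕ w)
          c′∈h = inClass-⊕w c∈h
          r≢0 : toℕ r ≢ 0
          r≢0 r≡0 = notClass1 (trans (cong (λ i → suc i % d) (sym (trans (onDiag-diagonal c) (trans (sym rc0) r≡0)))) c∈h)
          notExtra : suc (toℕ (c ⊕ w)) ≢ ℓ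
          notExtra c′ℓ with extraColumn-unique c′ℓ eℓ
          ... | refl = contradiction (trans (sym (classPos e c′∈h)) Ce) λ ()

-- For even k = 2h the odd diagonals 1, 3, …, k − 1, numbered u < h as
-- diagonal 2u + 1, are nearly closed under the move with R = (1, …, 1).
module EvenBand (n h₀ ℓ : ℕ) .{{_ : NonZero n}} (k<n : suc h₀ * 2 < n) (C : Fin n → Sgn) where

  open Torus {n}
  open PrefixCount C
  open AlmostDiagonal n (suc h₀ * 2) ℓ (s≤s (s≤s z≤n)) k<n
  open Moves C

  h : ℕ
  h = suc h₀

  odd<k : ∀ {u} → u < h → suc (u * 2) < suc h₀ * 2
  odd<k u<h = *-monoˡ-≤ 2 u<h

  OddCell : Cell n → ℕ → Set
  OddCell (r , c) u = u < h × OnDiag r c (suc (u * 2))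

  oddStart : ∀ u (u<h : u < h) → OddCell (fromℕ< (<-trans (odd<k u<h) k<n) , zeroF) u
  oddStart u u<h = u<h , trans (toℕ-fromℕ< _)
    (sym (trans (cong (λ i → (i + suc (u * 2)) % n) toℕ-zeroF) (m<n⇒m%n≡m (<-trans (odd<k u<h) k<n))))

  corner-notOdd : ∀ u → ¬ OddCell (zeroF , zeroF) u
  corner-notOdd u (u<h , odd) = contradiction
    (trans (sym (diagOffset-onDiag {zeroF} {zeroF} odd (<-trans (odd<k u<h) k<n)))
           (diagOffset-onDiag {zeroF} {zeroF} (onDiag-diagonal zeroF) 0<n))
    λ ()

  oddStep-pos : ∀ {r c u} → u < h → OnDiag r c (u * 2) → sc A (r , c) ≡ (r ⊕ 1 , c) × OddCell (r ⊕ 1 , c) u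
  oddStep-pos {r} {c} u<h rc = sc-adjacent rc (odd<k u<h) , u<h , onDiag-⊕row {r} {c} 1 rc

  oddStep-neg : ∀ {r c} u → u < h → OnDiag r c (u * 2) → (u ≡ 0 → suc (toℕ c) ≢ ℓ)
    → ∃[ r′ ] ∃[ u′ ] (sc⁻¹ A (r , c) ≡ (r′ , c) × OddCell (r′ , c) u′ × (u′ + 1) % h ≡ u % h)
  oddStep-neg {r} zero    _   rc0 notExtra =
    r ⊖ w , h₀ , sc⁻¹-gap rc0 (notExtra refl) , (≤-refl , onDiag-jumpUp rc0) ,
    trans (cong (_% h) (+-comm h₀ 1)) (n%n≡0 h)
  oddStep-neg {r} {c} (suc u) u<h rc _ =
    r ⊖ 1 , u , sc⁻¹-adjacent rc (<-trans (n<1+n _) (odd<k u<h)) ,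
    (<-trans (n<1+n u) u<h , onDiag-⊖row {r} {c} 1 (<⇒≤ 1<n) rc) , cong (_% h) (+-comm u 1)

  mv-oddCell : ∀ {r c u s} → OddCell (r , c) u → C (c ⊕ 1) ≡ s → mv (r , c) ≡ pow A s (sc A) (sc⁻¹ A) (r , c ⊕ 1)
  mv-oddCell {r} {c} (u<h , rcu) Cc′ =
    trans (mv-via-sr (sr-adjacent rcu (odd<k u<h))) (cong (λ s → pow A s (sc A) (sc⁻¹ A) (r , c ⊕ 1)) Cc′)

  oddStep : ∀ {r c u} → OddCell (r , c) u → (C (c ⊕ 1) ≡ neg → u ≡ 0 → suc (toℕ (c ⊕ 1)) ≢ ℓ)
    → ∃[ r′ ] ∃[ u′ ] (mv (r , c) ≡ (r′ , c ⊕ 1) × OddCell (r′ , c ⊕ 1) u′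
                       × (u′ + weight (C (c ⊕ 1))) % h ≡ u % h)
  oddStep {r} {c} {u} odd@(u<h , rcu) notExtra with C (c ⊕ 1) in Cc′
  ... | pos = r ⊕ 1 , u , trans (mv-oddCell odd Cc′) (proj₁ (oddStep-pos u<h rc′)) , proj₂ (oddStep-pos u<h rc′) ,
              cong (_% h) (+-identityʳ u)
    where
    rc′ : OnDiag r (c ⊕ 1) (u * 2)
    rc′ = onDiag-⊕col {r} {c} 1 rcu
  ... | neg with oddStep-neg u u<h (onDiag-⊕col {r} {c} 1 rcu) (notExtra refl)
  ...   | r′ , u′ , sc⁻¹≡ , odd′ , drop = r′ , u′ , trans (mv-oddCell odd Cc′) sc⁻¹≡ , odd′ , drop

  -- Part 1: if the extra column is positive, no move leaves the odd diagonals,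
  -- so (1 , 0) never reaches the corner (0 , 0).
  oddTrap : ∀ e → suc (toℕ e) ≡ ℓ → C e ≡ pos → ¬ IsSolution A (λ _ → pos) C
  oddTrap e eℓ Ce = noInvariantSet Odd invariant (_ , zeroF) (zeroF , zeroF)
    (filled (onDiag-filled (proj₂ (oddStart 0 0<h)) (odd<k 0<h)))
    (filled (onDiag-filled (onDiag-diagonal zeroF) 0<k))
    (0 , oddStart 0 0<h) (λ (u , odd) → corner-notOdd u odd)
    where
    0<h : 0 < h
    0<h = s≤s z≤n
    Odd : Cell n → Set
    Odd x = ∃[ u ] OddCell x u
    invariant : ∀ x → Odd x → Odd (mv x)
    invariant (r , c) (u , odd) =
      let (r′ , u′ , mv≡ , odd′ , _) = oddStep odd notExtra in subst Odd (sym mv≡) (u′ , odd′)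
      where
      notExtra : C (c ⊕ 1) ≡ neg → u ≡ 0 → suc (toℕ (c ⊕ 1)) ≢ ℓ
      notExtra Cneg _ c′ℓ with extraColumn-unique c′ℓ eℓ
      ... | refl = contradiction (trans (sym Cneg) Ce) λ ()

  -- Part 2: if g divides both h and |E|, then u + N c (mod g) is conserved
  -- along odd-diagonal cells as long as no move jumps through the extra cell.
  module _ (g : ℕ) .{{_ : NonZero g}} (g∣h : g ∣ h) (g∣E : g ∣ length (negPositions C))
    (e : Fin n) (eℓ : suc (toℕ e) ≡ ℓ) where

    -- Starting on odd diagonal 2u₀ + 1 of column 0 the conserved value is
    -- v = u₀ + N 0, and the jump would need v + 1 ≡ N e (mod g).
    balancedTrap : ∀ u₀ (u₀<h : u₀ < h) → suc (u₀ + N zeroF) % g ≢ N e % g → ¬ IsSolution A (λ _ → pos) C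
    balancedTrap u₀ u₀<h avoids = noInvariantSet Balanced invariant (_ , zeroF) (zeroF , zeroF)
      (filled (onDiag-filled (proj₂ (oddStart u₀ u₀<h)) (odd<k u₀<h)))
      (filled (onDiag-filled (onDiag-diagonal zeroF) 0<k))
      (u₀ , oddStart u₀ u₀<h , refl) (λ (u , odd , _) → corner-notOdd u odd)
      where
      v : ℕ
      v = u₀ + N zeroF
      Balanced : Cell n → Set
      Balanced (r , c) = ∃[ u ] (OddCell (r , c) u × (u + N c) % g ≡ v % g)
      invariant : ∀ x → Balanced x → Balanced (mv x)
      invariant (r , c) (u , odd , bal) =
        let (r′ , u′ , mv≡ , odd′ , drop) = oddStep odd notExtra
        in subst Balanced (sym mv≡) (u′ , odd′ , balanced u′ drop)
        where
        c′ : Fin n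
        c′ = c ⊕ 1
        -- A jump through the extra cell needs u = 0 and c′ = e, hence v + 1 ≡ N e.
        notExtra : C c′ ≡ neg → u ≡ 0 → suc (toℕ c′) ≢ ℓ
        notExtra Cneg refl c′ℓ with extraColumn-unique c′ℓ eℓ
        ... | refl = avoids (begin
          (1 + v) % g          ≡⟨ %-cong-+ {1} {1} g refl (sym bal) ⟩
          (1 + N c) % g        ≡⟨ cong (_% g) (+-comm 1 (N c)) ⟩
          (N c + 1) % g        ≡⟨ cong (λ s → (N c + weight s) % g) Cneg ⟨
          (N c + weight (C c′)) % g ≡⟨ N-step g g∣E c ⟨
          N c′ % g             ∎)
          where open ≡-Reasoning
        balanced : ∀ u′ → (u′ + weight (C c′)) % h ≡ u % h → (u′ + N c′) % g ≡ v % g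
        balanced u′ drop = begin
          (u′ + N c′) % g                 ≡⟨ %-cong-+ {u′} {u′} g refl (N-step g g∣E c) ⟩
          (u′ + (N c + weight (C c′))) % g ≡⟨ cong (λ x → (u′ + x) % g) (+-comm (N c) _) ⟩
          (u′ + (weight (C c′) + N c)) % g ≡⟨ cong (_% g) (+-assoc u′ _ (N c)) ⟨
          (u′ + weight (C c′) + N c) % g  ≡⟨ %-cong-+ g (%-weaken {u′ + weight (C c′)} {u} g∣h drop) refl ⟩
          (u + N c) % g                   ≡⟨ bal ⟩
          v % g                           ∎
          where open ≡-Reasoning

    -- For g ≥ 2 one of the starts on diagonals 1 and 3 of column 0 avoids the jump.
    countingTrap : 2 ≤ g → 1 < h → ¬ IsSolution A (λ _ → pos) C
    countingTrap 2≤g 1<h = start (suc (0 + N zeroF) % g ≟ N e % g)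
      where
      start : Dec (suc (0 + N zeroF) % g ≡ N e % g) → ¬ IsSolution A (λ _ → pos) C
      start (no avoids) = balancedTrap 0 (s≤s z≤n) avoids
      start (yes hits)  = balancedTrap 1 1<h (λ hits′ → suc-%-≢ 2≤g (suc (N zeroF)) (trans hits′ (sym hits)))

module SolutionProperties (n h₁ ℓ : ℕ) .{{_ : NonZero n}} (k<n : suc (suc h₁) * 2 < n)
  (C : Fin n → Sgn) (solution : IsSolution (almostDiag n (suc (suc h₁) * 2) ℓ) (λ _ → pos) C)
  (e : Fin n) (eℓ : suc (toℕ e) ≡ ℓ) where

  k : ℕ
  k = suc (suc h₁) * 2

  open AlmostDiagonal n k ℓ (s≤s (s≤s z≤n)) k<n
  open Moves C
  open EvenBand n (suc h₁) ℓ k<n C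

  extraColumn-neg : C e ≡ neg
  extraColumn-neg with C e in Ce
  ... | neg = refl
  ... | pos = ⊥-elim (oddTrap e eℓ Ce solution)

  column-ℓ-neg : ∀ j → suc (toℕ j) ≡ ℓ → C j ≡ neg
  column-ℓ-neg j jℓ = subst (λ c → C c ≡ neg) (sym (extraColumn-unique jℓ eℓ)) extraColumn-neg

  -- 2) |E| and h = k/2 are coprime: a common divisor g ≥ 2 gives the counting trap.
  negCount-coprime : Coprime (length (negPositions C)) h
  negCount-coprime {zero}        (_ , 0∣h) = contradiction (0∣⇒≡0 0∣h) λ ()
  negCount-coprime {suc zero}    _         = refl
  negCount-coprime {suc (suc g)} (g∣E , g∣h) =
    ⊥-elim (countingTrap (suc (suc g)) g∣h g∣E e eℓ (s≤s (s≤s z≤n)) (s≤s (s≤s z≤n)) solution)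

  -- 3) Modulo d = gcd(n, k − 1), every class other than that of 1 contains a
  -- negative column, since otherwise the main-diagonal trap applies.
  module _ (d : ℕ) .{{_ : NonZero d}} (d∣n : d ∣ n) (d∣k-1 : d ∣ k ∸ 1) where

    residueCovered : ∀ h′ → h′ % d ≢ 1 % d → ∃[ j ] (j ∈ negPositions C × suc (toℕ j) ≡ h′ [mod d ])
    residueCovered h′ h′≢1 with any? (λ j → suc (toℕ j) % d ≟ h′ % d) (negPositions C)
    ... | yes found = let (j , j∈E , class) = find found in j , j∈E , %≡⇒≡[mod] d class
    ... | no none = ⊥-elim (mainDiagonalTrap d d∣n d∣k-1 e eℓ extraColumn-neg h′ h′≢1 classPositive solution)
      where
      classPositive : ∀ c → suc (toℕ c) % d ≡ h′ % d → C c ≡ pos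
      classPositive c class with C c in Cc
      ... | pos = refl
      ... | neg = ⊥-elim (none (lose (∈-negPositions C Cc) class))

    -- The class of 1 is covered too when it contains ℓ, by the extra column.
    allResiduesCovered : ℓ ≡ 1 [mod d ] → ∀ h′ → ∃[ j ] (j ∈ negPositions C × suc (toℕ j) ≡ h′ [mod d ])
    allResiduesCovered ℓ≡1 h′ with h′ % d ≟ 1 % d
    ... | no h′≢1 = residueCovered h′ h′≢1
    ... | yes h′≡1 = e , ∈-negPositions C extraColumn-neg ,
                     %≡⇒≡[mod] d (trans (cong (_% d) eℓ) (trans (≡[mod]⇒%≡ d ℓ≡1) (sym h′≡1)))

proposition5p12 : (n k ℓ : ℕ) .{{_ : NonZero n}} → 4 ≤ k → 2 ∣ k → k < n
    → 2 ≤ ℓ → ℓ ≤ n ∸ k + 1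
    → (C : Fin n → Sgn)
    → IsSolution (almostDiag n k ℓ) (λ _ → pos) C
    → ((j : Fin n) → suc (toℕ j) ≡ ℓ → C j ≡ neg)
      × gcd (length (negPositions C)) (k / 2) ≡ 1
      × (ℓ ≡ 1 [mod gcd n (k ∸ 1) ]
          → (h : ℕ) → ∃[ j ] (j ∈ negPositions C × suc (toℕ j) ≡ h [mod gcd n (k ∸ 1) ]))
      × (¬ (ℓ ≡ 1 [mod gcd n (k ∸ 1) ])
          → (h : ℕ) → ¬ (h ≡ 1 [mod gcd n (k ∸ 1) ])
          → ∃[ j ] (j ∈ negPositions C × suc (toℕ j) ≡ h [mod gcd n (k ∸ 1) ]))
-- Write k = 2h; h ≤ 1 contradicts 4 ≤ k.  The four components are given by
-- SolutionProperties for the extra column e = ℓ − 1 and d = gcd(n, k − 1).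
proposition5p12 _ _ _ (s≤s (s≤s ())) (divides (suc zero) refl) _ _ _ _ _
proposition5p12 n _ ℓ 4≤k (divides h@(suc (suc h₁)) refl) k<n 2≤ℓ ℓ≤n-k+1 C solution =
  column-ℓ-neg ,
  coprime⇒gcd≡1 (subst (Coprime _) (sym (m*n/n≡m h 2)) negCount-coprime) ,
  (λ ℓ≡1 → allResiduesCovered d d∣n d∣k-1 ℓ≡1) ,
  (λ _ h′ h′≢1 → residueCovered d d∣n d∣k-1 h′ (λ h′≡1 → h′≢1 (%≡⇒≡[mod] d h′≡1)))
  where
  ℓ≤n : ℓ ≤ n
  ℓ≤n = ≤-trans ℓ≤n-k+1 (≤-trans (+-monoʳ-≤ (n ∸ h * 2) (s≤s z≤n)) (≤-reflexive (m∸n+n≡m (<⇒≤ k<n))))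
  extra : ∃[ e ] suc (toℕ e) ≡ ℓ
  extra = column {n} (≤-trans (s≤s z≤n) 2≤ℓ) ℓ≤n
  open SolutionProperties n h₁ ℓ k<n C solution (proj₁ extra) (proj₂ extra)
  d : ℕ
  d = gcd n (k ∸ 1)
  instance
    d≢0 : NonZero d
    d≢0 = ≢-nonZero (gcd[m,n]≢0 n (k ∸ 1) (inj₁ (≢-nonZero⁻¹ n)))
  d∣n : d ∣ n
  d∣n = gcd[m,n]∣m n (k ∸ 1)
  d∣k-1 : d ∣ k ∸ 1
  d∣k-1 = gcd[m,n]∣n n (k ∸ 1)
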